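{- Let $\langle\chi,\vec a\rangle$ be a loop and $\check\phi$ a quantifier-free formula over $\vec x$, where $\chi(\vec x)\equiv\bigwedge_{i=1}^k C_i$ in CNF and each clause $C_i$ contains an inequation $e_i(\vec x)>0$ (as one of its disjuncts) such that \[ \check\phi(\vec x)\land e_i(\vec x)\le e_i(\vec a(\vec x))\implies e_i(\vec a(\vec x))\le e_i(\vec a^2(\vec x)) \] is valid. Then the conditional acceleration technique mapping $(\langle\chi,\vec a\rangle,\check\phi)$ to \[ \vec x'=\vec a^n(\vec x)\land\bigwedge_{i=1}^k 0<e_i(\vec x)\le e_i(\vec a(\vec x)) \] is sound, i.e., for all $\vec x,\vec x'\in\mathbb Z^d$ and all $n>0$, $\vec x\longrightarrow^n_{\langle\check\phi,\vec a\rangle}\vec x'$ together with this formula implies $\vec x\longrightarrow^n_{\langle\chi,\vec a\rangle}\vec x'$.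
   Context: Fix $d\ge 1$, integer variables $\vec x=(x_1,\dots,x_d)$, $\vec x'$, and $n$ ranging over $\mathbb N$. A loop $\langle\chi,\vec a\rangle$ consists of a quantifier-free formula $\chi$ over atoms $p>0$ ($p$ an arithmetic expression over $\vec x$, integer semantics) and a map $\vec a:\mathbb Z^d\to\mathbb Z^d$ given by expressions over $\vec x$; $\vec a^m$ is $m$-fold application. $\vec x\longrightarrow_{\langle\chi,\vec a\rangle}\vec x'$ iff $\chi(\vec x)\land\vec x'=\vec a(\vec x)$, and $\longrightarrow^m$ is its $m$-fold composition; thus $\vec x\longrightarrow^m_{\langle\chi,\vec a\rangle}\vec x'$ iff $\vec x'=\vec a^m(\vec x)$ and $\chi(\vec a^i(\vec x))$ for all $0\le i<m$. Validity means truth for all integer values of the free variables. -}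

module Defs where

open import Data.Nat using (ℕ; zero; suc)
open import Data.Integer using (ℤ; +_) renaming (_+_ to _+ℤ_; _*_ to _*ℤ_; -_ to -ℤ_; _<_ to _<ℤ_)
open import Data.Fin using (Fin)
open import Data.Vec using (Vec; lookup; map)
open import Data.List using (List)
open import Data.List.Relation.Unary.Any using (Any)
open import Data.Product using (_×_)
open import Data.Sum using (_⊎_)
open import Data.Empty using (⊥)
open import Data.Unit using (⊤)
open import Relation.Nullary using (¬_)
open import Relation.Binary.PropositionalEquality using (_≡_)

data Expr (d : ℕ) : Set where
  const : ℤ → Expr d
  var   : Fin d → Expr d
  _⊕_   : Expr d → Expr d → Expr d
  _⊗_   : Expr d → Expr d → Expr d
  ⊖_    : Expr d → Expr d

eval : ∀ {d} → Expr d → Vec ℤ d → ℤ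
eval (const c) x = c
eval (var j)   x = lookup x j
eval (p ⊕ q)   x = eval p x +ℤ eval q x
eval (p ⊗ q)   x = eval p x *ℤ eval q x
eval (⊖ p)     x = -ℤ eval p x

data Formula (d : ℕ) : Set where
  tt    : Formula d
  ff    : Formula d
  atom  : Expr d → Formula d
  ¬'_   : Formula d → Formula d
  _∧'_  : Formula d → Formula d → Formula d
  _∨'_  : Formula d → Formula d → Formula d

⟦_⟧ : ∀ {d} → Formula d → Vec ℤ d → Set
⟦ tt ⟧ x = ⊤
⟦ ff ⟧ x = ⊥
⟦ atom p ⟧ x = + 0 <ℤ eval p x
⟦ ¬' φ ⟧ x = ¬ ⟦ φ ⟧ x
⟦ φ ∧' ψ ⟧ x = ⟦ φ ⟧ x × ⟦ ψ ⟧ x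
⟦ φ ∨' ψ ⟧ x = ⟦ φ ⟧ x ⊎ ⟦ ψ ⟧ x

data Literal (d : ℕ) : Set where
  pos : Expr d → Literal d
  neg : Expr d → Literal d

⟦_⟧ˡ : ∀ {d} → Literal d → Vec ℤ d → Set
⟦ pos p ⟧ˡ x = + 0 <ℤ eval p x
⟦ neg p ⟧ˡ x = ¬ (+ 0 <ℤ eval p x)

Clause : ℕ → Set
Clause d = List (Literal d)

CNF : ℕ → Set
CNF d = List (Clause d)

⟦_⟧ᶜ : ∀ {d} → Clause d → Vec ℤ d → Set
⟦ C ⟧ᶜ x = Any (λ l → ⟦ l ⟧ˡ x) C

clause→formula : ∀ {d} → Clause d → Formula d
clause→formula List.[] = ff
clause→formula (pos p List.∷ C) = atom p ∨' clause→formula C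
clause→formula (neg p List.∷ C) = (¬' atom p) ∨' clause→formula C

cnf→formula : ∀ {d} → CNF d → Formula d
cnf→formula List.[] = tt
cnf→formula (C List.∷ χ) = clause→formula C ∧' cnf→formula χ

Update : ℕ → Set
Update d = Vec (Expr d) d

apply : ∀ {d} → Update d → Vec ℤ d → Vec ℤ d
apply a x = map (λ p → eval p x) a

iter : ∀ {d} → Update d → ℕ → Vec ℤ d → Vec ℤ d
iter a zero x = x
iter a (suc m) x = apply a (iter a m x)

Steps : ∀ {d} → Formula d → Update d → ℕ → Vec ℤ d → Vec ℤ d → Set
Steps χ a m x x' = (x' ≡ iter a m x) × (∀ i → i Data.Nat.< m → ⟦ χ ⟧ (iter a i x))

{-# OPTIONS --safe #-}
module Submission where

-- Along a φ̌-run each eᵢ stays positive and non-decreasing: eᵢ(x) ≤ eᵢ(a(x)) holds at the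
-- start, the hypothesis pushes it one step further wherever φ̌ holds, and positivity is
-- preserved because the values never decrease. A positive eᵢ satisfies the i-th clause of χ.

open import Defs
open import Data.Nat using (ℕ; zero; suc; _>_) renaming (_<_ to _<ℕ_)
open import Data.Nat.Properties using (<-trans; n<1+n)
open import Data.Integer using (ℤ; +_; _<_; _≤_)
open import Data.Integer.Properties using (<-≤-trans)
open import Data.Vec using (Vec)
open import Data.List using (List; []; _∷_)
open import Data.List.Relation.Unary.All using (All; []; _∷_)
open import Data.List.Relation.Unary.Any using (here; there)
open import Data.List.Relation.Binary.Pointwise using (Pointwise; []; _∷_)
open import Data.List.Membership.Propositional using (_∈_)
open import Data.Product using (_×_; _,_; proj₁; proj₂)
open import Data.Sum using (inj₁; inj₂)
open import Relation.Binary.PropositionalEquality using (_≡_; refl)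

module _ {d : ℕ} where

  PositiveNondecreasingStep : Update d → Expr d → Vec ℤ d → Set
  PositiveNondecreasingStep a e x = (+ 0 < eval e x) × (eval e x ≤ eval e (iter a 1 x))

  StepMonotoneUnder : Formula d → Update d → Expr d → Set
  StepMonotoneUnder φ a e =
    ∀ x → ⟦ φ ⟧ x → eval e x ≤ eval e (iter a 1 x) → eval e (iter a 1 x) ≤ eval e (iter a 2 x)

  positiveNondecreasingStep-along-run :
    ∀ {φ a x n} e → StepMonotoneUnder φ a e → (∀ i → i <ℕ n → ⟦ φ ⟧ (iter a i x))
    → PositiveNondecreasingStep a e x
    → ∀ i → i <ℕ n → PositiveNondecreasingStep a e (iter a i x)
  positiveNondecreasingStep-along-run e mono run start zero _ = start
  positiveNondecreasingStep-along-run {a = a} {x} e mono run start (suc i) 1+i<n =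
    <-≤-trans 0<eᵢ eᵢ≤eᵢ₊₁ , mono (iter a i x) (run i i<n) eᵢ≤eᵢ₊₁
    where
    i<n = <-trans (n<1+n i) 1+i<n
    0<eᵢ    = proj₁ (positiveNondecreasingStep-along-run e mono run start i i<n)
    eᵢ≤eᵢ₊₁ = proj₂ (positiveNondecreasingStep-along-run e mono run start i i<n)

  positive-along-run :
    ∀ {φ a x n} es → All (StepMonotoneUnder φ a) es → (∀ i → i <ℕ n → ⟦ φ ⟧ (iter a i x))
    → All (λ e → PositiveNondecreasingStep a e x) es
    → ∀ i → i <ℕ n → All (λ e → + 0 < eval e (iter a i x)) es
  positive-along-run []       []           run []             i i<n = []
  positive-along-run (e ∷ es) (mono ∷ ms) run (start ∷ starts) i i<n =
    proj₁ (positiveNondecreasingStep-along-run e mono run start i i<n)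
    ∷ positive-along-run es ms run starts i i<n

  clause-holds-if-positive-literal :
    ∀ {e} (C : Clause d) y → pos e ∈ C → + 0 < eval e y → ⟦ clause→formula C ⟧ y
  clause-holds-if-positive-literal (pos p ∷ C) y (here refl) 0<e = inj₁ 0<e
  clause-holds-if-positive-literal (pos p ∷ C) y (there e∈C) 0<e =
    inj₂ (clause-holds-if-positive-literal C y e∈C 0<e)
  clause-holds-if-positive-literal (neg p ∷ C) y (there e∈C) 0<e =
    inj₂ (clause-holds-if-positive-literal C y e∈C 0<e)

  cnf-holds-if-positive-literals : ∀ (χ : CNF d) {es} y → Pointwise (λ C e → pos e ∈ C) χ es
    → All (λ e → + 0 < eval e y) es → ⟦ cnf→formula χ ⟧ y
  cnf-holds-if-positive-literals []      y []         []           = _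
  cnf-holds-if-positive-literals (C ∷ χ) y (e∈C ∷ ws) (0<e ∷ 0<es) =
    clause-holds-if-positive-literal C y e∈C 0<e , cnf-holds-if-positive-literals χ y ws 0<es

theorem13 : (d : ℕ) → d > 0 → (χ : CNF d) → (a : Update d) → (φ̌ : Formula d)
    → (es : List (Expr d))
    → Pointwise (λ C e → pos e ∈ C) χ es
    → All (λ e → ∀ (x : Vec ℤ d) → ⟦ φ̌ ⟧ x → eval e x ≤ eval e (iter a 1 x)
                   → eval e (iter a 1 x) ≤ eval e (iter a 2 x)) es
    → ∀ (x x' : Vec ℤ d) (n : ℕ) → n > 0
    → Steps φ̌ a n x x'
    → (x' ≡ iter a n x) × All (λ e → (+ 0 < eval e x) × (eval e x ≤ eval e (iter a 1 x))) es
    → Steps (cnf→formula χ) a n x x'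
theorem13 d _ χ a φ̌ es witnesses monotone x x' n _ (x'≡aⁿx , run) (_ , starts) =
  x'≡aⁿx , λ i i<n →
    cnf-holds-if-positive-literals χ (iter a i x) witnesses (positive-along-run es monotone run starts i i<n)
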